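{- For every language $L\subseteq\Sigma^+$: if $\Sigma^+\setminus L$ is generated by a linear conjunctive grammar, then $L\in\mathtt{incl}\text{ - }\mathtt{ESO}\text{ - }\mathtt{HORN}$.
   Context: Word structures: for a finite alphabet $\Sigma$ and a nonempty word $w=w_1\dots w_n\in\Sigma^n$, let $\langle w\rangle=([1,n];(Q_s)_{s\in\Sigma},\mathtt{min},\mathtt{max},\mathtt{suc},\mathtt{pred})$ with $Q_s(i)\iff w_i=s$, $\mathtt{min}(i)\iff i=1$, $\mathtt{max}(i)\iff i=n$, $\mathtt{suc}(i)=i+1$ for $i<n$, $\mathtt{suc}(n)=n$, $\mathtt{pred}(i)=i-1$ for $i>1$, $\mathtt{pred}(1)=1$. For $a\in\mathbb{Z}$, $x+a$ denotes $\mathtt{suc}^a(x)$ if $a\ge0$ and $\mathtt{pred}^{ -a}(x)$ if $a<0$; $x-b$ denotes $x+(-b)$. A formula $\Phi$ defines $\{w\in\Sigma^+:\langle w\rangle\models\Phi\}$. Inclusion Horn formulas ($\mathtt{incl}\text{ - }\mathtt{ESO}\text{ - }\mathtt{HORN}$): $\Phi=\exists\mathbf{R}\,\forall x\forall y\,\psi(x,y)$ with $\mathbf{R}$ a finite set of binary predicate symbols and $\psi$ a finite conjunction of Horn clauses $x\le y\wedge\delta_1\wedge\dots\wedge\delta_r\to\delta_0$, where $\delta_0$ is $R(x,y)$ ($R\in\mathbf{R}$) or $\bot$, and each $\delta_i$ ($i\ge1$) is one of: $U(x+a)$, $\neg U(x+a)$, $U(y+a)$, $\neg U(y+a)$ ($U\in\{(Q_s)_{s\in\Sigma},\mathtt{min},\mathtt{max}\}$,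 $a\in\mathbb{Z}$); $x=y$ or $x<y$; $S(x+a,y-b)\wedge x+a\le y-b$ ($S\in\mathbf{R}$, $a,b\ge0$). Linear conjunctive grammars: $G=(\Sigma,N,P,S)$ with finite nonterminal set $N$, start symbol $S$, rules $A\to\alpha_1\&\dots\&\alpha_k$ ($k\ge1$) where each $\alpha_i$ is a terminal string or $uBv$ with $u,v\in\Sigma^*$, $B\in N$; the languages $L(A)$ form the least solution of $L(A)=\bigcup_{A\to\alpha_1\&\dots\&\alpha_k\in P}\bigcap_iL(\alpha_i)$, and $L(G)=L(S)$. -}

module Defs where

open import Data.Nat using (ℕ; zero; suc; _≤_; _<_; _<ᵇ_)
open import Data.Integer using (ℤ; +_; -[1+_]; -_)
open import Data.Fin using (Fin)
open import Data.Bool using (Bool; true; false; if_then_else_)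
open import Data.List using (List; []; _∷_; _++_; length)
open import Data.List.NonEmpty using (List⁺; toList)
open import Data.List.Membership.Propositional using (_∈_)
open import Data.List.Relation.Unary.All using (All)
open import Data.Maybe using (Maybe; just; nothing)
open import Data.Product using (Σ; _×_; _,_; Σ-syntax)
open import Data.Empty using (⊥)
open import Relation.Nullary using (¬_)
open import Relation.Binary.PropositionalEquality using (_≡_; _≢_)
open import Function.Bundles using (_⇔_)
open import Level using (0ℓ) renaming (suc to lsuc)

-- The finite alphabet Σ is Fin k (any finite alphabet is, up to renaming, of this form).
-- Words are lists over Fin k; a language L ⊆ Σ⁺ is given by its
-- characteristic function on words (its value on the empty word is irrelevant).

Word : ℕ → Set
Word k = List (Fin k)

Language : ℕ → Set
Language k = Word k → Bool

-- Word structures ⟨w⟩ : domain [1,n] (positions are 1-indexed naturals)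

at : ∀ {A : Set} → List A → ℕ → Maybe A
at []       _             = nothing
at (x ∷ xs) zero          = nothing
at (x ∷ xs) (suc zero)    = just x
at (x ∷ xs) (suc (suc i)) = at xs (suc i)

sucW : ℕ → ℕ → ℕ
sucW n i = if i <ᵇ n then suc i else i

predW : ℕ → ℕ
predW zero          = zero
predW (suc zero)    = suc zero
predW (suc (suc i)) = suc i

iter : ℕ → (ℕ → ℕ) → ℕ → ℕ
iter zero    f x = x
iter (suc m) f x = f (iter m f x)

-- x + a  (a ∈ ℤ) in the structure of a word of length n
shift : ℕ → ℕ → ℤ → ℕ
shift n x (+ a)      = iter a (sucW n) x
shift n x -[1+ a ]   = iter (suc a) predW x

data UPred (k : ℕ) : Set where
  Q   : Fin k → UPred k
  Min : UPred k
  Max : UPred k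

holdsU : ∀ {k} → Word k → UPred k → ℕ → Set
holdsU w (Q s) i = at w i ≡ just s
holdsU w Min   i = i ≡ 1
holdsU w Max   i = i ≡ length w

data Var : Set where
  vx vy : Var

data Atom (k r : ℕ) : Set where
  -- U(v+a) if the Bool is true, ¬U(v+a) if false
  unary : Bool → UPred k → Var → ℤ → Atom k r
  eqxy  : Atom k r
  ltxy  : Atom k r
  -- S(x+a, y-b) ∧ x+a ≤ y-b   (a b : ℕ)
  rel   : Fin r → ℕ → ℕ → Atom k r

-- Horn clause  x ≤ y ∧ δ_1 ∧ … ∧ δ_r → δ_0 ;  head nothing = ⊥, just R = R(x,y)
record Clause (k r : ℕ) : Set where
  constructor clause
  field
    body : List (Atom k r)
    head : Maybe (Fin r)

-- Φ = ∃R ∀x∀y ψ(x,y), R = {R_0,…,R_{r-1}} binary, ψ a conjunction of clauses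
record InclHornFormula (k : ℕ) : Set where
  constructor formula
  field
    nrel    : ℕ
    clauses : List (Clause k nrel)

open InclHornFormula public

Interp : ℕ → Set₁
Interp r = Fin r → ℕ → ℕ → Set

varVal : Var → ℕ → ℕ → ℕ
varVal vx x y = x
varVal vy x y = y

⟦_⟧A : ∀ {k r} → Atom k r → Word k → Interp r → ℕ → ℕ → Set
⟦ unary true  U v a ⟧A w I x y = holdsU w U (shift (length w) (varVal v x y) a)
⟦ unary false U v a ⟧A w I x y = ¬ holdsU w U (shift (length w) (varVal v x y) a)
⟦ eqxy ⟧A w I x y = x ≡ y
⟦ ltxy ⟧A w I x y = x < y
⟦ rel S a b ⟧A w I x y =
  I S (shift (length w) x (+ a)) (shift (length w) y (- (+ b)))
  × shift (length w) x (+ a) ≤ shift (length w) y (- (+ b))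

⟦_⟧H : ∀ {r} → Maybe (Fin r) → Interp r → ℕ → ℕ → Set
⟦ nothing ⟧H I x y = ⊥
⟦ just R  ⟧H I x y = I R x y

⟦_⟧C : ∀ {k r} → Clause k r → Word k → Interp r → ℕ → ℕ → Set
⟦ clause body head ⟧C w I x y =
  x ≤ y → All (λ δ → ⟦ δ ⟧A w I x y) body → ⟦ head ⟧H I x y

_⊨_ : ∀ {k} → Word k → InclHornFormula k → Set₁
w ⊨ Φ = Σ[ I ∈ Interp (nrel Φ) ]
  (∀ x y → 1 ≤ x → x ≤ length w → 1 ≤ y → y ≤ length w →
     All (λ c → ⟦ c ⟧C w I x y) (clauses Φ))

InInclESOHorn : ∀ {k} → Language k → Set₁
InInclESOHorn {k} L = Σ[ Φ ∈ InclHornFormula k ]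
  (∀ (w : Word k) → w ≢ [] → (w ⊨ Φ) ⇔ (L w ≡ true))

data Conj (k m : ℕ) : Set where
  term : Word k → Conj k m
  lin  : Word k → Fin m → Word k → Conj k m

record LCG (k : ℕ) : Set where
  constructor lcg
  field
    nnt   : ℕ
    rules : List (Fin nnt × List⁺ (Conj k nnt))  -- A → α₁ & … & α_j  (j ≥ 1)
    start : Fin nnt

open LCG public

-- L(A) as the least solution of the system of language equations
-- (inductively generated = least fixed point)
mutual
  data Gen {k} (G : LCG k) : Fin (nnt G) → Word k → Set where
    byRule : ∀ {A αs w} → (A , αs) ∈ rules G →
             (∀ α → α ∈ toList αs → ConjGen G α w) → Gen G A w

  data ConjGen {k} (G : LCG k) : Conj k (nnt G) → Word k → Set where
    cterm : ∀ {t} → ConjGen G (term t) t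
    clin  : ∀ {u B v w} → Gen G B w → ConjGen G (lin u B v) (u ++ w ++ v)

Generates : ∀ {k} → LCG k → Word k → Set
Generates G w = Gen G (start G) w

module Submission where

-- For a linear conjunctive grammar G, a nonempty word w lies outside L(G) iff ⟨w⟩ satisfies
-- Horn clauses read off G together with R_S(min,max) → ⊥, where R_A(x,y) is meant to say
-- w[x..y] ∈ L(A) and E_A to say ε ∈ L(A).
-- A conjunct u B v derives w[x..y] iff u and v are read at x + a and y − b by unary atoms
-- and either R_B holds on the nonempty middle, or the middle is empty and E_B holds. This
-- is a disjunction of conjunctions of body atoms, so distributing each rule
-- A → α₁ & … & αₖ over it yields Horn clauses with head R_A (and likewise for E_A).
-- Conversely every model of these clauses contains the intended R_A and E_A, by induction
-- on derivations, so the start clause rules out w ∈ L(S).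

open import Data.Nat using (ℕ; zero; suc; _+_; _≤_; _<_; _<ᵇ_; z≤n; s≤s)
open import Data.Nat.Properties
open import Data.Integer using (+_; -_)
open import Data.Bool using (true; false)
open import Data.Bool.Properties using (¬-not; not-¬)
open import Data.Fin using (Fin; zero; suc; _↑ˡ_; _↑ʳ_; splitAt)
open import Data.Fin.Properties using (splitAt-↑ˡ; splitAt-↑ʳ)
open import Data.Sum using ([_,_]′)
open import Relation.Nullary using (¬_)
open import Data.Empty using (⊥-elim)
open import Data.List using (List; []; _∷_; _++_; length; map; concatMap; cartesianProductWith)
open import Data.List.NonEmpty using (List⁺; toList)
open import Data.List.Membership.Propositional using (_∈_; lose)
open import Data.List.Properties using (length-++)
open import Data.List.Relation.Unary.All as All using (All; []; _∷_)
import Data.List.Relation.Unary.All.Properties as All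
open import Data.List.Relation.Unary.Any as Any using (Any; here; there)
open import Data.List.Relation.Unary.Any.Properties as Any using (cartesianProductWith⁺; cartesianProductWith⁻)
open import Data.Product using (_×_; _,_; ∃-syntax; Σ-syntax; proj₁; proj₂)
open import Function.Bundles using (_⇔_; mk⇔; Equivalence)
open import Data.Unit using (⊤; tt)
open import Data.Maybe using (Maybe; just; nothing)
open import Function using (_∘_; id)
open import Relation.Binary.PropositionalEquality
open import Defs

nonempty⇒1≤length : ∀ {A : Set} {xs : List A} → xs ≢ [] → 1 ≤ length xs
nonempty⇒1≤length {xs = []}    []≢[] = ⊥-elim ([]≢[] refl)
nonempty⇒1≤length {xs = _ ∷ _} _     = s≤s z≤n

module _ {A B : Set} (f : A → List (List B)) where

  choices : List A → List (List B)
  choices []       = [] ∷ []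
  choices (a ∷ as) = cartesianProductWith _++_ (f a) (choices as)

  Any-All-choices⁺ : ∀ {P : B → Set} {as} → All (Any (All P) ∘ f) as → Any (All P) (choices as)
  Any-All-choices⁺ []       = here []
  Any-All-choices⁺ (p ∷ ps) = cartesianProductWith⁺ _++_ All.++⁺ p (Any-All-choices⁺ ps)

  Any-All-choices⁻ : ∀ {P : B → Set} as → Any (All P) (choices as) → All (Any (All P) ∘ f) as
  Any-All-choices⁻ []       _ = []
  Any-All-choices⁻ (a ∷ as) p =
    let pa , pas = cartesianProductWith⁻ _++_ (λ {o} → All.++⁻ o) (f a) (choices as) p
    in pa ∷ Any-All-choices⁻ as pas

sucW-< : ∀ {n i} → i < n → sucW n i ≡ suc i
sucW-< {n} {i} i<n with i <ᵇ n | <⇒<ᵇ i<n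
... | true | _ = refl

shift-suc : ∀ {n p} x j → shift n x (+ j) ≡ p → p < n → shift n x (+ suc j) ≡ suc p
shift-suc {n} x j eq p<n = trans (cong (sucW n) eq) (sucW-< p<n)

shift-forward : ∀ n p j → p + j ≤ n → shift n p (+ j) ≡ p + j
shift-forward n p zero    _     = sym (+-identityʳ p)
shift-forward n p (suc j) bound =
  let p+j<n = subst (_≤ n) (+-suc p j) bound
  in trans (shift-suc p j (shift-forward n p j (<⇒≤ p+j<n)) p+j<n) (sym (+-suc p j))

iter-predW : ∀ {e} j → 1 ≤ e → iter j predW (e + j) ≡ e
iter-predW {e} zero    _   = +-identityʳ e
iter-predW {suc e} (suc j) _ =
  cong predW (trans (cong (iter j predW) (+-suc (suc e) j)) (iter-predW j (s≤s z≤n)))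

shift-backward : ∀ n {e} j → 1 ≤ e → shift n (e + j) (- (+ j)) ≡ e
shift-backward n zero    = iter-predW zero
shift-backward n (suc j) = iter-predW (suc j)

module _ {k : ℕ} where

  Occurs : Word k → ℕ → Word k → Set
  Occurs w p []      = ⊤
  Occurs w p (c ∷ s) = at w p ≡ just c × Occurs w (suc p) s

  -- s = w[x .. z − 1], with 1-indexed positions as in at.
  Segment : Word k → ℕ → ℕ → Word k → Set
  Segment w x z s = Occurs w x s × x + length s ≡ z

  Occurs-++⁺ : ∀ {w b} p a → Occurs w p a → Occurs w (p + length a) b → Occurs w p (a ++ b)
  Occurs-++⁺ {w} {b} p []      _            occ-b = subst (λ q → Occurs w q b) (+-identityʳ p) occ-b
  Occurs-++⁺ {w} {b} p (c ∷ a) (wc , occ-a) occ-b =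
    wc , Occurs-++⁺ (suc p) a occ-a (subst (λ q → Occurs w q b) (+-suc p (length a)) occ-b)

  Occurs-++⁻ : ∀ {w b} p a → Occurs w p (a ++ b) → Occurs w p a × Occurs w (p + length a) b
  Occurs-++⁻ {w} {b} p []      occ-b = tt , subst (λ q → Occurs w q b) (sym (+-identityʳ p)) occ-b
  Occurs-++⁻ {w} {b} p (c ∷ a) (wc , occ) =
    let occ-a , occ-b = Occurs-++⁻ (suc p) a occ
    in (wc , occ-a) , subst (λ q → Occurs w q b) (sym (+-suc p (length a))) occ-b

  Occurs-unique : ∀ {w p} s s′ → Occurs w p s → Occurs w p s′ → length s ≡ length s′ → s ≡ s′
  Occurs-unique []      []        _          _            _   = refl
  Occurs-unique (c ∷ s) (c′ ∷ s′) (wc , occ) (wc′ , occ′) len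
    with refl ← trans (sym wc) wc′ = cong (c ∷_) (Occurs-unique s s′ occ occ′ (suc-injective len))

  Occurs-∷ : ∀ {w c p} s → Occurs w (suc p) s → Occurs (c ∷ w) (suc (suc p)) s
  Occurs-∷ []      _          = tt
  Occurs-∷ (d ∷ s) (wd , occ) = wd , Occurs-∷ s occ

  Occurs-self : ∀ w → Occurs w 1 w
  Occurs-self []      = tt
  Occurs-self (c ∷ w) = refl , Occurs-∷ w (Occurs-self w)

  Segment-++⁺ : ∀ {w x y z a b} → Segment w x y a → Segment w y z b → Segment w x z (a ++ b)
  Segment-++⁺ {w} {x} {a = a} {b} (occ-a , refl) (occ-b , refl) =
    Occurs-++⁺ x a occ-a occ-b ,
    trans (cong (λ l → x + l) (length-++ a)) (sym (+-assoc x (length a) (length b)))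

  Segment-++⁻ : ∀ {w x z b} a → Segment w x z (a ++ b) →
                Segment w x (x + length a) a × Segment w (x + length a) z b
  Segment-++⁻ {x = x} {b = b} a (occ , len) =
    let occ-a , occ-b = Occurs-++⁻ x a occ
    in (occ-a , refl) ,
       (occ-b , trans (+-assoc x (length a) (length b)) (trans (cong (λ l → x + l) (sym (length-++ a))) len))

  Segment-unique : ∀ {w x z s s′} → Segment w x z s → Segment w x z s′ → s ≡ s′
  Segment-unique {x = x} {s = s} {s′} (occ , len) (occ′ , len′) =
    Occurs-unique s s′ occ occ′ (+-cancelˡ-≡ x _ _ (trans len (sym len′)))

  Segment-frame⁻ : ∀ {w x z} u d s v → Segment w x z (u ++ d ∷ s ++ v) →
                   let e = x + length u + length s in
                   Occurs w x u × Segment w (x + length u) (suc e) (d ∷ s) × Segment w (suc e) z v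
  Segment-frame⁻ {w} {x} {z} u d s v seg =
    let (occ-u , _) , seg-sv = Segment-++⁻ u seg
        seg-s , seg-v        = Segment-++⁻ (d ∷ s) seg-sv
        end                  = +-suc (x + length u) (length s)
    in occ-u , subst (λ q → Segment w (x + length u) q (d ∷ s)) end seg-s ,
       subst (λ q → Segment w q z v) end seg-v

-- The ¬ max (¬ min) atoms keep sucW (predW) from stalling at the end (start) of the word,
-- so that the shifts in the following atoms are exact.
prefixAtoms : ∀ {k r} → ℕ → Word k → List (Atom k r)
prefixAtoms j []      = []
prefixAtoms j (c ∷ u) = unary true (Q c) vx (+ j) ∷ unary false Max vx (+ j) ∷ prefixAtoms (suc j) u

suffixAtoms : ∀ {k r} → Word k → List (Atom k r)
suffixAtoms []      = []
suffixAtoms (c ∷ v) =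
  unary true (Q c) vy (- (+ length v)) ∷ unary false Min vy (- (+ length v)) ∷ suffixAtoms v

-- Atoms cannot compare x + a with y − b; the length of c ∷ t is fixed through ≐ instead.
spellings : ∀ {k r} → Fin r → Word k → List (List (Atom k r))
spellings ≐ []      = []
spellings ≐ (c ∷ t) = (unary true (Q c) vx (+ 0) ∷ rel ≐ 0 (length t) ∷ suffixAtoms t) ∷ []

frameAtoms : ∀ {k r} → Fin r → Word k → Word k → List (Atom k r)
frameAtoms R u v = prefixAtoms 0 u ++ suffixAtoms v ++ rel R (length u) (length v) ∷ []

Holds : ∀ {k r} → Word k → Interp r → ℕ → ℕ → List (Atom k r) → Set
Holds w I x y = All (λ δ → ⟦ δ ⟧A w I x y)

module Satisfaction {k r : ℕ} (w : Word k) (I : Interp r) (x y : ℕ) where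

  private
    n : ℕ
    n = length w

  prefixAtoms-sound : ∀ j p u → shift n x (+ j) ≡ p → p ≤ n → Holds w I x y (prefixAtoms j u) →
                      Occurs w p u × p + length u ≤ n
  prefixAtoms-sound j p []      _  p≤n _ = tt , subst (_≤ n) (sym (+-identityʳ p)) p≤n
  prefixAtoms-sound j p (c ∷ u) eq p≤n (wc ∷ ¬max ∷ h) =
    let p<n = ≤∧≢⇒< p≤n (¬max ∘ trans eq)
        occ , bound = prefixAtoms-sound (suc j) (suc p) u (shift-suc x j eq p<n) p<n h
    in (subst (λ q → at w q ≡ just c) eq wc , occ) , subst (_≤ n) (sym (+-suc p (length u))) bound

  prefixAtoms-complete : ∀ j p u → shift n x (+ j) ≡ p → Occurs w p u → p + length u ≤ n →
                         Holds w I x y (prefixAtoms j u)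
  prefixAtoms-complete j p []      _  _          _     = []
  prefixAtoms-complete j p (c ∷ u) eq (wc , occ) bound =
    let bound′ = subst (_≤ n) (+-suc p (length u)) bound
        p<n    = m+n≤o⇒m≤o (suc p) bound′
    in subst (λ q → at w q ≡ just c) (sym eq) wc ∷ <⇒≢ p<n ∘ trans (sym eq) ∷
       prefixAtoms-complete (suc j) (suc p) u (shift-suc x j eq p<n) occ bound′

  shift-y-back : ∀ {e} (v : Word k) → 1 ≤ e → suc (e + length v) ≡ suc y → shift n y (- (+ length v)) ≡ e
  shift-y-back {e} v 1≤e len =
    subst (λ q → shift n q (- (+ length v)) ≡ e) (suc-injective len) (shift-backward n (length v) 1≤e)

  suffixAtoms-sound : ∀ v → 1 ≤ y → Holds w I x y (suffixAtoms v) → ∃[ e ] 1 ≤ e × Segment w (suc e) (suc y) v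
  suffixAtoms-sound []      1≤y []               = y , 1≤y , tt , cong suc (+-identityʳ y)
  suffixAtoms-sound (c ∷ v) 1≤y (wc ∷ ¬min ∷ h) with suffixAtoms-sound v 1≤y h
  ... | suc (suc e) , _ , occ , len =
    suc e , s≤s z≤n ,
    (subst (λ q → at w q ≡ just c) (shift-y-back v (s≤s z≤n) len) wc , occ) ,
    trans (cong suc (+-suc (suc e) (length v))) len
  ... | suc zero    , _ , occ , len = ⊥-elim (¬min (shift-y-back v (s≤s z≤n) len))

  suffixAtoms-complete : ∀ {e} v → 1 ≤ e → Segment w (suc e) (suc y) v → Holds w I x y (suffixAtoms v)
  suffixAtoms-complete         []      _   _                  = []
  suffixAtoms-complete {e} (c ∷ v) 1≤e ((wc , occ) , len) =
    let seg = occ , trans (cong suc (sym (+-suc e (length v)))) len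
        sh  = shift-y-back v (s≤s z≤n) (proj₂ seg)
    in subst (λ q → at w q ≡ just c) (sym sh) wc ∷ (λ at1 → <⇒≢ (s≤s 1≤e) (trans (sym at1) sh)) ∷
       suffixAtoms-complete v (s≤s z≤n) seg

  module _ (≐ : Fin r) where

    spellings-sound : (∀ {a b} → I ≐ a b → a ≡ b) → 1 ≤ y → ∀ t →
                      Any (Holds w I x y) (spellings ≐ t) → Segment w x (suc y) t
    spellings-sound ≐⇒≡ 1≤y (c ∷ t) (here (wc ∷ (x≐ , _) ∷ h))
      with e , 1≤e , occ , len ← suffixAtoms-sound t 1≤y h
      with refl ← trans (≐⇒≡ x≐) (shift-y-back t 1≤e len)
      = (wc , occ) , trans (+-suc x (length t)) len

    spellings-complete : (∀ {a} → 1 ≤ a → a ≤ n → I ≐ a a) → 1 ≤ x → x ≤ y → y ≤ n → ∀ t →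
                         Segment w x (suc y) t → Any (Holds w I x y) (spellings ≐ t)
    spellings-complete _ _ x≤y _ [] (_ , len) =
      ⊥-elim (1+n≰n (subst (_≤ y) (trans (sym (+-identityʳ x)) len) x≤y))
    spellings-complete ≐-refl 1≤x x≤y y≤n (c ∷ t) ((wc , occ) , len) =
      let seg = occ , trans (sym (+-suc x (length t))) len
          sh  = shift-y-back t 1≤x (proj₂ seg)
      in here (wc ∷ (subst (I ≐ x) (sym sh) (≐-refl 1≤x (≤-trans x≤y y≤n)) , ≤-reflexive (sym sh)) ∷
               suffixAtoms-complete t 1≤x seg)

  frame-sound : ∀ R u v → x ≤ n → 1 ≤ y →
                Holds w I x y (frameAtoms R u v) →
                ∃[ e ] Occurs w x u × Segment w (suc e) (suc y) v × I R (x + length u) e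
  frame-sound R u v x≤n 1≤y h =
    let hu , hv,r       = All.++⁻ (prefixAtoms 0 u) h
        hv , hr         = All.++⁻ (suffixAtoms v) hv,r
        occ-u , bound   = prefixAtoms-sound 0 x u refl x≤n hu
        e , 1≤e , seg-v = suffixAtoms-sound v 1≤y hv
    in e , occ-u , seg-v ,
       subst₂ (I R) (shift-forward n x (length u) bound) (shift-y-back v 1≤e (proj₂ seg-v)) (proj₁ (All.head hr))

  frame-complete : ∀ R {e} u v → Occurs w x u → x + length u ≤ e → 1 ≤ e → e ≤ n →
                   Segment w (suc e) (suc y) v → I R (x + length u) e →
                   Holds w I x y (frameAtoms R u v)
  frame-complete R u v occ-u a≤e 1≤e e≤n seg-v i =
    let bound = ≤-trans a≤e e≤n
        sh-x  = sym (shift-forward n x (length u) bound)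
        sh-y  = sym (shift-y-back v 1≤e (proj₂ seg-v))
    in All.++⁺ (prefixAtoms-complete 0 x u refl occ-u bound)
         (All.++⁺ (suffixAtoms-complete v 1≤e seg-v) ((subst₂ (I R) sh-x sh-y i , subst₂ _≤_ sh-x sh-y a≤e) ∷ []))

withHead : ∀ {k r} → Maybe (Fin r) → List (List (Atom k r)) → List (Clause k r)
withHead h = map (λ body → clause body h)

module _ {k r} {w : Word k} {I : Interp r} {x y : ℕ} {h : Maybe (Fin r)} where

  All-withHead⁺ : ∀ {bodies} → (x ≤ y → Any (Holds w I x y) bodies → ⟦ h ⟧H I x y) →
                  All (λ c → ⟦ c ⟧C w I x y) (withHead h bodies)
  All-withHead⁺ head = All.map⁺ (All.tabulate λ body∈ x≤y holds → head x≤y (lose body∈ holds))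

  All-withHead⁻ : ∀ {bodies} → All (λ c → ⟦ c ⟧C w I x y) (withHead h bodies) →
                  x ≤ y → Any (Holds w I x y) bodies → ⟦ h ⟧H I x y
  All-withHead⁻ clauses x≤y = All.lookupWith (λ holds → holds x≤y) (All.map⁻ clauses)

module HornEncoding {k : ℕ} (G : LCG k) where

  private
    m : ℕ
    m = nnt G

  -- Intended meaning: ≐ᵢ is equality (the formula only forces it to be reflexive),
  -- Rᵢ A x y says w[x..y] ∈ L(A), and Eᵢ A says ε ∈ L(A).
  r : ℕ
  r = suc (m + m)

  ≐ᵢ : Fin r
  ≐ᵢ = zero

  Rᵢ Eᵢ : Fin m → Fin r
  Rᵢ A = suc (A ↑ˡ m)
  Eᵢ A = suc (m ↑ʳ A)

  spanOptions : Conj k m → List (List (Atom k r))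
  spanOptions (term t)    = spellings ≐ᵢ t
  spanOptions (lin u B v) =
    frameAtoms (Rᵢ B) u v ∷ map (rel (Eᵢ B) 0 0 ∷_) (spellings ≐ᵢ (u ++ v))

  emptyOptions : Conj k m → List (List (Atom k r))
  emptyOptions (term [])     = [] ∷ []
  emptyOptions (lin [] B []) = (rel (Eᵢ B) 0 0 ∷ []) ∷ []
  emptyOptions _             = []

  ruleClauses : Fin m × List⁺ (Conj k m) → List (Clause k r)
  ruleClauses (A , αs) = withHead (just (Rᵢ A)) (choices spanOptions (toList αs)) ++
                         withHead (just (Eᵢ A)) (choices emptyOptions (toList αs))

  reflClause startClause : Clause k r
  reflClause  = clause (eqxy ∷ []) (just ≐ᵢ)
  startClause = clause (rel (Rᵢ (start G)) 0 0 ∷ unary true Min vx (+ 0) ∷ unary true Max vy (+ 0) ∷ []) nothing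

  Φ : InclHornFormula k
  Φ = formula r (reflClause ∷ startClause ∷ concatMap ruleClauses (rules G))

  module IntendedModel (w : Word k) where

    private
      n : ℕ
      n = length w

    Derives : Fin m → ℕ → ℕ → Set
    Derives A x y = ∃[ s ] Gen G A s × Segment w x (suc y) s

    Nullable : Fin m → ℕ → ℕ → Set
    Nullable A _ _ = Gen G A []

    Intended : Interp r
    Intended zero    = _≡_
    Intended (suc i) = [ Derives , Nullable ]′ (splitAt m i)

    Intended-R : ∀ A {x y} → Intended (Rᵢ A) x y ≡ Derives A x y
    Intended-R A {x} {y} = cong (λ i → [ Derives , Nullable ]′ i x y) (splitAt-↑ˡ m A m)

    Intended-E : ∀ A {x y} → Intended (Eᵢ A) x y ≡ Gen G A []
    Intended-E A {x} {y} = cong (λ i → [ Derives , Nullable ]′ i x y) (splitAt-↑ʳ m m A)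

    derives-byRule : ∀ {A αs x y} → (A , αs) ∈ rules G →
                     All (λ α → ∃[ s ] ConjGen G α s × Segment w x (suc y) s) (toList αs) → Derives A x y
    derives-byRule ρ∈ conjs@((s , _ , seg) ∷ _) = s , byRule ρ∈ agree , seg
      where
      agree : ∀ α → α ∈ _ → ConjGen G α s
      agree α α∈ = let _ , g , seg′ = All.lookup conjs α∈ in subst (ConjGen G α) (Segment-unique seg′ seg) g

    module _ {x y : ℕ} (x≤n : x ≤ n) (1≤y : 1 ≤ y) where
      open Satisfaction w Intended x y

      spanConj-sound : ∀ α → Any (Holds w Intended x y) (spanOptions α) →
                       ∃[ s ] ConjGen G α s × Segment w x (suc y) s
      spanConj-sound (term t) h = t , cterm , spellings-sound ≐ᵢ id 1≤y t h
      spanConj-sound (lin u B v) (here h) =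
        let e , occ-u , seg-v , d = frame-sound (Rᵢ B) u v x≤n 1≤y h
            s , g , seg-s         = subst id (Intended-R B) d
        in u ++ s ++ v , clin g , Segment-++⁺ (occ-u , refl) (Segment-++⁺ seg-s seg-v)
      spanConj-sound (lin u B v) (there h) =
        let h′ = Any.map⁻ h
            ε , _ = All.head (proj₂ (Any.satisfied h′))
        in u ++ v , clin (subst id (Intended-E B) ε) , spellings-sound ≐ᵢ id 1≤y (u ++ v) (Any.map All.tail h′)

    emptyConj-sound : ∀ {x y} α → Any (Holds w Intended x y) (emptyOptions α) → ConjGen G α []
    emptyConj-sound (term [])          _                     = cterm
    emptyConj-sound (lin [] B [])      (here ((ε , _) ∷ [])) = clin (subst id (Intended-E B) ε)
    emptyConj-sound (term (_ ∷ _))     ()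
    emptyConj-sound (lin [] B (_ ∷ _)) ()
    emptyConj-sound (lin (_ ∷ _) B _)  ()

    Intended-satisfies : ¬ Generates G w → ∀ x y → 1 ≤ x → x ≤ n → 1 ≤ y → y ≤ n →
                         All (λ c → ⟦ c ⟧C w Intended x y) (clauses Φ)
    Intended-satisfies ¬gen x y _ x≤n 1≤y _ =
      (λ { _ (x≡y ∷ []) → x≡y }) ∷ startHolds ∷ All.concat⁺ (All.map⁺ (All.tabulate ruleHolds))
      where
      startHolds : ⟦ startClause ⟧C w Intended x y
      startHolds _ ((d , _) ∷ x≡1 ∷ y≡n ∷ []) =
        let s , g , seg = subst id (Intended-R (start G)) (subst₂ (Intended (Rᵢ (start G))) x≡1 y≡n d)
        in ¬gen (subst (Gen G (start G)) (Segment-unique seg (Occurs-self w , refl)) g)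

      ruleHolds : ∀ {ρ} → ρ ∈ rules G → All (λ c → ⟦ c ⟧C w Intended x y) (ruleClauses ρ)
      ruleHolds {A , αs} ρ∈ = All.++⁺
        (All-withHead⁺ λ _ h → subst id (sym (Intended-R A))
          (derives-byRule ρ∈ (All.map (λ {α} → spanConj-sound x≤n 1≤y α) (Any-All-choices⁻ spanOptions (toList αs) h))))
        (All-withHead⁺ λ _ h → subst id (sym (Intended-E A))
          (byRule ρ∈ λ α α∈ → emptyConj-sound α (All.lookup (Any-All-choices⁻ emptyOptions (toList αs) h) α∈)))

  module ModelRefutes (w : Word k) (I : Interp r)
    (I⊨Φ : ∀ x y → 1 ≤ x → x ≤ length w → 1 ≤ y → y ≤ length w → All (λ c → ⟦ c ⟧C w I x y) (clauses Φ)) where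

    private
      n : ℕ
      n = length w

    ≐-refl : ∀ {a} → 1 ≤ a → a ≤ n → I ≐ᵢ a a
    ≐-refl 1≤a a≤n = All.head (I⊨Φ _ _ 1≤a a≤n 1≤a a≤n) ≤-refl (refl ∷ [])

    ruleClauses-hold : ∀ {ρ x y} → ρ ∈ rules G → 1 ≤ x → x ≤ y → y ≤ n →
                       All (λ c → ⟦ c ⟧C w I x y) (ruleClauses ρ)
    ruleClauses-hold ρ∈ 1≤x x≤y y≤n =
      All.lookup (All.map⁻ (All.concat⁻ (All.tail (All.tail
        (I⊨Φ _ _ 1≤x (≤-trans x≤y y≤n) (≤-trans 1≤x x≤y) y≤n))))) ρ∈

    mutual
      nullable⇒E : ∀ {A x y} → Gen G A [] → 1 ≤ x → x ≤ y → y ≤ n → I (Eᵢ A) x y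
      nullable⇒E (byRule {A} {αs} ρ∈ conj) 1≤x x≤y y≤n =
        All-withHead⁻ (All.++⁻ʳ (withHead (just (Rᵢ A)) (choices spanOptions (toList αs)))
                                (ruleClauses-hold ρ∈ 1≤x x≤y y≤n))
          x≤y (Any-All-choices⁺ emptyOptions (All.tabulate λ {α} α∈ → emptyConj-complete (conj α α∈) refl 1≤x x≤y y≤n))

      emptyConj-complete : ∀ {α s x y} → ConjGen G α s → s ≡ [] → 1 ≤ x → x ≤ y → y ≤ n →
                           Any (Holds w I x y) (emptyOptions α)
      emptyConj-complete cterm refl _ _ _ = here []
      emptyConj-complete (clin {[]} {v = []} {[]} g) refl 1≤x x≤y y≤n =
        here ((nullable⇒E g 1≤x x≤y y≤n , x≤y) ∷ [])
      emptyConj-complete (clin {_ ∷ _} _)               ()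
      emptyConj-complete (clin {[]} {w = _ ∷ _} _)      ()
      emptyConj-complete (clin {[]} {v = _ ∷ _} {[]} _) ()

    mutual
      derives⇒R : ∀ {A s x y} → Gen G A s → Segment w x (suc y) s → 1 ≤ x → x ≤ y → y ≤ n → I (Rᵢ A) x y
      derives⇒R (byRule {A} {αs} ρ∈ conj) seg 1≤x x≤y y≤n =
        All-withHead⁻ (All.++⁻ˡ (withHead (just (Rᵢ A)) (choices spanOptions (toList αs)))
                                (ruleClauses-hold ρ∈ 1≤x x≤y y≤n))
          x≤y (Any-All-choices⁺ spanOptions (All.tabulate λ {α} α∈ → spanConj-complete (conj α α∈) seg 1≤x x≤y y≤n))

      spanConj-complete : ∀ {α s x y} → ConjGen G α s → Segment w x (suc y) s → 1 ≤ x → x ≤ y → y ≤ n →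
                          Any (Holds w I x y) (spanOptions α)
      spanConj-complete {x = x} {y} (cterm {t}) seg 1≤x x≤y y≤n =
        Satisfaction.spellings-complete w I x y ≐ᵢ ≐-refl 1≤x x≤y y≤n t seg
      spanConj-complete {x = x} {y} (clin {u} {B} {v} {[]} g) seg 1≤x x≤y y≤n =
        there (Any.map⁺ (Any.map ((nullable⇒E g 1≤x x≤y y≤n , x≤y) ∷_)
          (Satisfaction.spellings-complete w I x y ≐ᵢ ≐-refl 1≤x x≤y y≤n (u ++ v) seg)))
      spanConj-complete {x = x} (clin {u} {B} {v} {d ∷ s} g) seg 1≤x x≤y y≤n =
        let occ-u , seg-s , seg-v = Segment-frame⁻ u d s v seg
            a   = x + length u
            1≤a = ≤-trans 1≤x (m≤m+n x (length u))
            a≤e = m≤m+n a (length s)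
            e≤n = ≤-trans (m+n≤o⇒m≤o (a + length s) (≤-reflexive (suc-injective (proj₂ seg-v)))) y≤n
        in here (Satisfaction.frame-complete w I x _ (Rᵢ B) u v occ-u a≤e (≤-trans 1≤a a≤e) e≤n seg-v
                   (derives⇒R g seg-s 1≤a a≤e e≤n))

    refutes : 1 ≤ n → ¬ Generates G w
    refutes 1≤n g =
      All.head (All.tail (I⊨Φ 1 n ≤-refl 1≤n 1≤n ≤-refl)) 1≤n
        ((derives⇒R g (Occurs-self w , refl) ≤-refl 1≤n ≤-refl , 1≤n) ∷ refl ∷ refl ∷ [])

  Φ-defines-complement : ∀ w → w ≢ [] → (w ⊨ Φ) ⇔ (¬ Generates G w)
  Φ-defines-complement w w≢[] = mk⇔
    (λ (I , I⊨Φ) → ModelRefutes.refutes w I I⊨Φ (nonempty⇒1≤length w≢[]))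
    (λ ¬gen → IntendedModel.Intended w , IntendedModel.Intended-satisfies w ¬gen)

lemma8 : ∀ {k : ℕ} (L : Language k) →
    (Σ[ G ∈ LCG k ] (∀ (w : Word k) → Generates G w ⇔ (w ≢ [] × L w ≡ false))) →
    InInclESOHorn L
lemma8 L (G , G⇔∁L) = Φ , λ w w≢[] →
  let Φ⇔∁G = Φ-defines-complement w w≢[]
  in mk⇔ (λ w⊨Φ → ¬-not λ Lw≡false → to Φ⇔∁G w⊨Φ (from (G⇔∁L w) (w≢[] , Lw≡false)))
         (λ Lw≡true → from Φ⇔∁G λ gen → not-¬ Lw≡true (proj₂ (to (G⇔∁L w) gen)))
  where open HornEncoding G using (Φ; Φ-defines-complement)
        open Equivalence
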